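{- Let $R$ be a finite commutative ring with unit in which $1+1$ is invertible, and let $h:G\to R\times R$ be a surjective homomorphism from a finite group $G$ onto the additive group of the ring $R\times R$, with kernel $K=h^{ -1}(0,0)$. Then $$\Delta[G]\le \Delta[K]\cdot|R|-|\mathrm{Spec}(R)|+\sum_{I\in\mathrm{Spec}(R)}\Delta[h^{ -1}(I\times R)].$$ If moreover $R$ is local with maximal ideal $I_{\mathfrak m}$, then $\Delta[G]\le \Delta[K]\cdot|R|-1+\Delta[h^{ -1}(I_{\mathfrak m}\times R)]$.
   Context: For a subset $A$ of a group $G$, a subset $B\subseteq G$ is a difference basis for $A$ if every $a\in A$ can be written as $a=xy^{ -1}$ with $x,y\in B$. The difference size $\Delta[A]$ is the smallest cardinality of a difference basis for $A$. $\mathrm{Spec}(R)$ denotes the set of maximal ideals of $R$ (ideals are proper). A ring is local if it has a unique maximal ideal. -}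

module Defs where

open import Level using (0ℓ)
open import Data.Nat using (ℕ; _≤_)
open import Data.Fin using (Fin)
open import Data.Product using (Σ; ∃; ∃-syntax; _×_; _,_; proj₁)
open import Data.List using (List; length)
open import Data.List.Membership.Propositional using (_∈_)
open import Relation.Nullary using (¬_)
open import Data.Unit using (⊤)
open import Relation.Binary.PropositionalEquality using (_≡_)
open import Function.Bundles using (_⇔_)
open import Algebra.Bundles using (Group; CommutativeRing)
import Algebra.Construct.DirectProduct as DP
open import Algebra.Morphism.Structures using (module GroupMorphisms)

record HasCardinality (Car : Set) (_≈_ : Car → Car → Set) (n : ℕ) : Set where
  field
    enum  : Fin n → Car
    surj  : ∀ x → ∃[ i ] (enum i ≈ x)
    inj   : ∀ i j → enum i ≈ enum j → i ≡ j

IsFinite : (Car : Set) (_≈_ : Car → Car → Set) → Set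
IsFinite Car _≈_ = ∃[ n ] HasCardinality Car _≈_ n

-- Subsets of G are predicates on the carrier; a (finite) subset B ⊆ G is
-- given by a list of its elements, its cardinality being the length
-- (for the minimum this is harmless: duplicates only make a list longer).

module _ (G : Group 0ℓ 0ℓ) where
  open Group G

  IsDifferenceBasis : (A : Carrier → Set) → List Carrier → Set
  IsDifferenceBasis A B =
    ∀ a → A a → ∃[ x ] ∃[ y ] (x ∈ B × y ∈ B × a ≈ (x ∙ (y ⁻¹)))

  DifferenceSize : (A : Carrier → Set) → ℕ → Set
  DifferenceSize A n =
    (∃[ B ] (IsDifferenceBasis A B × length B ≡ n)) ×
    (∀ B → IsDifferenceBasis A B → n ≤ length B)

  Whole : Carrier → Set
  Whole _ = ⊤

module _ (R : CommutativeRing 0ℓ 0ℓ) where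
  open CommutativeRing R

  record IsIdeal (I : Carrier → Set) : Set where
    field
      resp    : ∀ {x y} → x ≈ y → I x → I y
      zero∈   : I 0#
      +-closed : ∀ {x y} → I x → I y → I (x + y)
      *-closed : ∀ r {x} → I x → I (r * x)
      proper  : ¬ I 1#

  _⊆_ : (I J : Carrier → Set) → Set
  I ⊆ J = ∀ x → I x → J x

  _≐_ : (I J : Carrier → Set) → Set
  I ≐ J = ∀ x → I x ⇔ J x

  record IsMaximalIdeal (I : Carrier → Set) : Set₁ where
    field
      isIdeal : IsIdeal I
      maximal : ∀ J → IsIdeal J → I ⊆ J → J ⊆ I

  -- `SpecEnumeration s M` : M : Fin s → subsets is a repetition-free
  -- enumeration of Spec(R) (up to extensional equality of subsets),
  -- hence |Spec(R)| = s.
  record SpecEnumeration (s : ℕ) (M : Fin s → Carrier → Set) : Set₁ where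
    field
      allMaximal : ∀ i → IsMaximalIdeal (M i)
      complete   : ∀ J → IsMaximalIdeal J → ∃[ i ] (M i ≐ J)
      distinct   : ∀ i j → M i ≐ M j → i ≡ j

  TwoInvertible : Set
  TwoInvertible = ∃[ u ] ((1# + 1#) * u ≈ 1#)

  IsLocalWith : (Carrier → Set) → Set₁
  IsLocalWith I = IsMaximalIdeal I × (∀ J → IsMaximalIdeal J → J ≐ I)

  R×R-group : Group 0ℓ 0ℓ
  R×R-group = DP.group +-group +-group

module _ (G : Group 0ℓ 0ℓ) (R : CommutativeRing 0ℓ 0ℓ) where
  private
    module G = Group G
    module RR = Group (R×R-group R)

  IsSurjectiveHom : (G.Carrier → RR.Carrier) → Set
  IsSurjectiveHom h =
    GroupMorphisms.IsGroupHomomorphism G.rawGroup RR.rawGroup h ×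
    (∀ y → ∃[ g ] (h g RR.≈ y))

  Kernel : (G.Carrier → RR.Carrier) → G.Carrier → Set
  Kernel h g = h g RR.≈ RR.ε

  PreimageIdeal×R : (G.Carrier → RR.Carrier) → (CommutativeRing.Carrier R → Set) →
                   G.Carrier → Set
  PreimageIdeal×R h I g = I (proj₁ (h g))

module Submission where

-- If h g = (a , b) with a a unit, then since 2 is invertible (a , b) = (x , x²) − (y , y²) for
-- some x, y.  With lifts l_z ∈ G of the points (z , z²), the element l_x⁻¹ g l_y lies in K, so g
-- is a difference of the |R| · Δ[K] elements l_z k, k in a minimal basis of K.  Otherwise
-- h g ∈ I × R for a maximal ideal I, and a minimal basis of h⁻¹(I × R), translated on the right
-- so that one of its elements lands among the l_z k, contributes Δ[h⁻¹(I × R)] − 1 new elements.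

open import Defs
open import Level using (0ℓ)
open import Data.Nat using (ℕ; zero; suc; _≤_; _+_; _*_)
open import Data.Nat.ListAction using (sum)
open import Data.Fin using (Fin)
open import Data.List using (List; []; _∷_; _++_; map; concat; foldl; tabulate; length)
open import Data.List.Properties using (length-++; length-map; length-tabulate; tabulate-cong)
open import Data.List.Membership.Propositional using (_∈_)
open import Data.List.Membership.Propositional.Properties using (∈-++⁺ˡ; ∈-++⁺ʳ; ∈-map⁺; ∈-tabulate⁺; ∈-concat⁺′)
open import Data.List.Relation.Unary.Any using (here; there)
open import Data.List.Relation.Binary.Subset.Propositional using () renaming (_⊆_ to _⊆ˡ_)
open import Data.Product using (Σ; ∃; ∃-syntax; ∃₂; _×_; _,_; proj₁; proj₂)
open import Function using (_∘_)
open import Data.Empty using (⊥-elim)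
open import Function.Construct.Symmetry using (⇔-sym)
open import Function.Bundles using (Equivalence)
open import Data.Sum using (_⊎_; inj₁; inj₂)
import Relation.Binary.PropositionalEquality as ≡
open ≡ using (_≡_)
open import Algebra.Bundles using (Group; CommutativeRing)
open import Algebra.Morphism.Structures using (module GroupMorphisms)
import Data.Nat.Properties as ℕ
import Data.Fin.Properties as FinP
open import Relation.Nullary using (¬_; Dec; yes; no)
open import Relation.Nullary.Decidable using (map′; _×-dec_)
open import Relation.Binary.Definitions using (Decidable)
import Relation.Binary.Reasoning.Setoid

length-concat-tabulate : ∀ {A : Set} {n} (f : Fin n → List A) →
  length (concat (tabulate f)) ≡ sum (tabulate (λ i → length (f i)))
length-concat-tabulate {n = zero} f = ≡.refl
length-concat-tabulate {n = suc n} f = ≡.trans (length-++ (f Fin.zero))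
  (≡.cong (length (f Fin.zero) +_) (length-concat-tabulate (λ i → f (Fin.suc i))))

sum-tabulate-suc : ∀ {n} (f : Fin n → ℕ) → sum (tabulate (λ i → suc (f i))) ≡ sum (tabulate f) + n
sum-tabulate-suc {zero} f = ≡.refl
sum-tabulate-suc {suc n} f = begin
  suc (f Fin.zero + sum (tabulate (λ i → suc (f (Fin.suc i)))))
    ≡⟨ ≡.cong (λ m → suc (f Fin.zero + m)) (sum-tabulate-suc (λ i → f (Fin.suc i))) ⟩
  suc (f Fin.zero + (sum (tabulate (λ i → f (Fin.suc i))) + n))
    ≡⟨ ≡.cong suc (ℕ.+-assoc (f Fin.zero) _ n) ⟨
  suc (sum (tabulate f) + n)
    ≡⟨ ℕ.+-suc _ n ⟨
  sum (tabulate f) + suc n ∎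
  where open ≡.≡-Reasoning

module DifferenceSets (G : Group 0ℓ 0ℓ) where
  open Group G
  open import Algebra.Properties.Group G using (⁻¹-anti-homo-∙; \\-leftDividesˡ; //-rightDividesʳ)
  private module ≈-Reasoning = Relation.Binary.Reasoning.Setoid setoid

  IsDifferenceOf : List Carrier → Carrier → Set
  IsDifferenceOf B g = ∃[ x ] ∃[ y ] (x ∈ B × y ∈ B × g ≈ x ∙ y ⁻¹)

  isDifferenceOf-mono : ∀ {B B′ g} → (∀ {x} → x ∈ B → ∃[ x′ ] (x′ ∈ B′ × x ≈ x′)) →
                        IsDifferenceOf B g → IsDifferenceOf B′ g
  isDifferenceOf-mono B≲B′ (x , y , x∈B , y∈B , g≈xy⁻¹)
    with x′ , x′∈B′ , x≈x′ ← B≲B′ x∈B | y′ , y′∈B′ , y≈y′ ← B≲B′ y∈B =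
    x′ , y′ , x′∈B′ , y′∈B′ , trans g≈xy⁻¹ (∙-cong x≈x′ (⁻¹-cong y≈y′))

  isDifferenceOf-⊆ : ∀ {B B′ g} → B ⊆ˡ B′ → IsDifferenceOf B g → IsDifferenceOf B′ g
  isDifferenceOf-⊆ B⊆B′ = isDifferenceOf-mono (λ x∈B → _ , B⊆B′ x∈B , refl)

  ∙-∙⁻¹-cancelʳ : ∀ x y w → (x ∙ w) ∙ (y ∙ w) ⁻¹ ≈ x ∙ y ⁻¹
  ∙-∙⁻¹-cancelʳ x y w = begin
    (x ∙ w) ∙ (y ∙ w) ⁻¹     ≈⟨ ∙-congˡ (⁻¹-anti-homo-∙ y w) ⟩
    (x ∙ w) ∙ (w ⁻¹ ∙ y ⁻¹)  ≈⟨ assoc x w _ ⟩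
    x ∙ (w ∙ (w ⁻¹ ∙ y ⁻¹))  ≈⟨ ∙-congˡ (\\-leftDividesˡ w (y ⁻¹)) ⟩
    x ∙ y ⁻¹                 ∎
    where open ≈-Reasoning

  isDifferenceOf-∙ʳ : ∀ {B g} w → IsDifferenceOf B g → IsDifferenceOf (map (_∙ w) B) g
  isDifferenceOf-∙ʳ w (x , y , x∈B , y∈B , g≈xy⁻¹) =
    x ∙ w , y ∙ w , ∈-map⁺ (_∙ w) x∈B , ∈-map⁺ (_∙ w) y∈B ,
    trans g≈xy⁻¹ (sym (∙-∙⁻¹-cancelʳ x y w))

  -- Right translation by c⁻¹ ∙ b preserves differences and sends c to b ∈ B.
  isDifferenceOf-reanchor : ∀ {B b c t g} → b ∈ B → map (_∙ (c ⁻¹ ∙ b)) t ⊆ˡ B →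
                            IsDifferenceOf (c ∷ t) g → IsDifferenceOf B g
  isDifferenceOf-reanchor {B} {b} {c} b∈B t′⊆B =
    isDifferenceOf-mono translate∈B ∘ isDifferenceOf-∙ʳ (c ⁻¹ ∙ b)
    where
      translate∈B : ∀ {x} → x ∈ map (_∙ (c ⁻¹ ∙ b)) (c ∷ _) → ∃[ x′ ] (x′ ∈ B × x ≈ x′)
      translate∈B (here ≡.refl) = b , b∈B , \\-leftDividesˡ c b
      translate∈B (there x∈t′) = _ , t′⊆B x∈t′ , refl

  minimalBasis-∷ : ∀ {A a n} → A a → DifferenceSize G A n →
                   ∃₂ λ c t → IsDifferenceBasis G A (c ∷ t) × length (c ∷ t) ≡ n
  minimalBasis-∷ _  ((c ∷ t , basis , |B|≡n) , _) = c , t , basis , |B|≡n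
  minimalBasis-∷ Aa (([] , basis , _) , _) with () ← proj₁ (proj₂ (proj₂ (basis _ Aa)))

  anchoredUnion : List Carrier → Carrier → ∀ {s} → (Fin s → Carrier) → (Fin s → List Carrier) →
                  List Carrier
  anchoredUnion B₀ b c t = B₀ ++ concat (tabulate λ i → map (_∙ (c i ⁻¹ ∙ b)) (t i))

  anchoredUnion-basis : ∀ {B₀ b s c t} {A : Carrier → Set} {Aᵢ : Fin s → Carrier → Set} →
    b ∈ B₀ → (∀ i → IsDifferenceBasis G (Aᵢ i) (c i ∷ t i)) →
    (∀ g → A g → IsDifferenceOf B₀ g ⊎ ∃[ i ] Aᵢ i g) →
    IsDifferenceBasis G A (anchoredUnion B₀ b c t)
  anchoredUnion-basis {B₀} b∈B₀ bases cover g Ag with cover g Ag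
  ... | inj₁ g∈ΔB₀ = isDifferenceOf-⊆ ∈-++⁺ˡ g∈ΔB₀
  ... | inj₂ (i , Aᵢg) = isDifferenceOf-reanchor (∈-++⁺ˡ b∈B₀)
          (λ x∈tᵢ → ∈-++⁺ʳ B₀ (∈-concat⁺′ x∈tᵢ (∈-tabulate⁺ i))) (bases i g Aᵢg)

  length-anchoredUnion : ∀ B₀ b {s} (c : Fin s → Carrier) t →
    length (anchoredUnion B₀ b c t) + s ≡ length B₀ + sum (tabulate λ i → length (c i ∷ t i))
  length-anchoredUnion B₀ b {s} c t = begin
    length (B₀ ++ concat (tabulate tᵢ′)) + s          ≡⟨ ≡.cong (_+ s) (length-++ B₀) ⟩
    (length B₀ + length (concat (tabulate tᵢ′))) + s  ≡⟨ ℕ.+-assoc (length B₀) _ s ⟩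
    length B₀ + (length (concat (tabulate tᵢ′)) + s)  ≡⟨ ≡.cong (λ m → length B₀ + (m + s)) lengths ⟩
    length B₀ + (sum (tabulate λ i → length (t i)) + s)
      ≡⟨ ≡.cong (length B₀ +_) (sum-tabulate-suc (λ i → length (t i))) ⟨
    length B₀ + sum (tabulate λ i → length (c i ∷ t i)) ∎
    where
      open ≡.≡-Reasoning
      tᵢ′ : Fin s → List Carrier
      tᵢ′ i = map (_∙ (c i ⁻¹ ∙ b)) (t i)
      lengths : length (concat (tabulate tᵢ′)) ≡ sum (tabulate λ i → length (t i))
      lengths = ≡.trans (length-concat-tabulate tᵢ′)
                        (≡.cong sum (tabulate-cong λ i → length-map _ (t i)))

  leftTranslates : List Carrier → List Carrier → List Carrier
  leftTranslates L B = concat (map (λ l → map (l ∙_) B) L)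

  ∈-leftTranslates : ∀ {L B l x} → l ∈ L → x ∈ B → l ∙ x ∈ leftTranslates L B
  ∈-leftTranslates {B = B} l∈L x∈B = ∈-concat⁺′ (∈-map⁺ _ x∈B) (∈-map⁺ (λ l → map (l ∙_) B) l∈L)

  length-leftTranslates : ∀ L B → length (leftTranslates L B) ≡ length L * length B
  length-leftTranslates [] B = ≡.refl
  length-leftTranslates (l ∷ L) B = ≡.trans (length-++ (map (l ∙_) B))
    (≡.cong₂ _+_ (length-map (l ∙_) B) (length-leftTranslates L B))

  ∙-∙⁻¹-unconjugate : ∀ l m g k k′ → (l ⁻¹ ∙ g) ∙ m ≈ k ∙ k′ ⁻¹ → g ≈ (l ∙ k) ∙ (m ∙ k′) ⁻¹
  ∙-∙⁻¹-unconjugate l m g k k′ e = sym (begin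
    (l ∙ k) ∙ (m ∙ k′) ⁻¹         ≈⟨ ∙-congˡ (⁻¹-anti-homo-∙ m k′) ⟩
    (l ∙ k) ∙ (k′ ⁻¹ ∙ m ⁻¹)      ≈⟨ assoc l k _ ⟩
    l ∙ (k ∙ (k′ ⁻¹ ∙ m ⁻¹))      ≈⟨ ∙-congˡ (assoc k (k′ ⁻¹) (m ⁻¹)) ⟨
    l ∙ ((k ∙ k′ ⁻¹) ∙ m ⁻¹)      ≈⟨ ∙-congˡ (∙-congʳ e) ⟨
    l ∙ (((l ⁻¹ ∙ g) ∙ m) ∙ m ⁻¹) ≈⟨ ∙-congˡ (//-rightDividesʳ m (l ⁻¹ ∙ g)) ⟩
    l ∙ (l ⁻¹ ∙ g)                ≈⟨ \\-leftDividesˡ l g ⟩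
    g                             ∎)
    where open ≈-Reasoning

  isDifferenceOf-unconjugate : ∀ {L B l m g} → l ∈ L → m ∈ L →
    IsDifferenceOf B ((l ⁻¹ ∙ g) ∙ m) → IsDifferenceOf (leftTranslates L B) g
  isDifferenceOf-unconjugate {l = l} {m} {g} l∈L m∈L (k , k′ , k∈B , k′∈B , e) =
    l ∙ k , m ∙ k′ , ∈-leftTranslates l∈L k∈B , ∈-leftTranslates m∈L k′∈B ,
    ∙-∙⁻¹-unconjugate l m g k k′ e

module _ {G H : Group 0ℓ 0ℓ} {f : Group.Carrier G → Group.Carrier H}
         (isHom : GroupMorphisms.IsGroupHomomorphism (Group.rawGroup G) (Group.rawGroup H) f) where
  private
    module G = Group G
    module H = Group H
  open GroupMorphisms.IsGroupHomomorphism isHom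
  open Relation.Binary.Reasoning.Setoid H.setoid

  homo-conjugate≈ε : ∀ l g m → f g H.∙ f m H.≈ f l → f ((l G.⁻¹ G.∙ g) G.∙ m) H.≈ H.ε
  homo-conjugate≈ε l g m fgfm≈fl = begin
    f ((l G.⁻¹ G.∙ g) G.∙ m)        ≈⟨ homo (l G.⁻¹ G.∙ g) m ⟩
    f (l G.⁻¹ G.∙ g) H.∙ f m        ≈⟨ H.∙-congʳ (homo (l G.⁻¹) g) ⟩
    (f (l G.⁻¹) H.∙ f g) H.∙ f m    ≈⟨ H.∙-congʳ (H.∙-congʳ (⁻¹-homo l)) ⟩
    (f l H.⁻¹ H.∙ f g) H.∙ f m      ≈⟨ H.assoc (f l H.⁻¹) (f g) (f m) ⟩
    f l H.⁻¹ H.∙ (f g H.∙ f m)      ≈⟨ H.∙-congˡ fgfm≈fl ⟩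
    f l H.⁻¹ H.∙ f l                ≈⟨ H.inverseˡ (f l) ⟩
    H.ε                             ∎

module _ (R : CommutativeRing 0ℓ 0ℓ) where
  open CommutativeRing R renaming (_+_ to _⊕_; _*_ to _⊛_)
  open import Algebra.Properties.Group +-group using (//-rightDividesˡ)
  open import Algebra.Solver.Ring.NaturalCoefficients.Default commutativeSemiring
    using (solve; _:=_; _:+_; _:*_)
  open Relation.Binary.Reasoning.Setoid setoid

  IsUnit : Carrier → Set
  IsUnit a = ∃[ u ] (u ⊛ a ≈ 1#)

  half+half≈1 : ∀ {t} → (1# ⊕ 1#) ⊛ t ≈ 1# → t ⊕ t ≈ 1#
  half+half≈1 {t} 2t≈1 = begin
    t ⊕ t              ≈⟨ +-cong (*-identityˡ t) (*-identityˡ t) ⟨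
    1# ⊛ t ⊕ 1# ⊛ t    ≈⟨ distribʳ t 1# 1# ⟨
    (1# ⊕ 1#) ⊛ t      ≈⟨ 2t≈1 ⟩
    1#                 ∎

  -- With x = a ⊕ y this says (a , b) = (x , x²) − (y , y²) in R × R.
  parabola-difference : TwoInvertible R → ∀ {a} → IsUnit a → ∀ b →
                        ∃[ y ] (b ⊕ y ⊛ y ≈ (a ⊕ y) ⊛ (a ⊕ y))
  parabola-difference (t , 2t≈1) {a} (u , ua≈1) b = y , (begin
    b ⊕ y ⊛ y                    ≈⟨ +-comm b (y ⊛ y) ⟩
    y ⊛ y ⊕ b                    ≈⟨ +-congˡ a[y+y+a]≈b ⟨
    y ⊛ y ⊕ a ⊛ ((y ⊕ y) ⊕ a)    ≈⟨ square-expand ⟨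
    (a ⊕ y) ⊛ (a ⊕ y)            ∎)
    where
      y : Carrier
      y = t ⊛ (u ⊛ b ⊕ - a)
      square-expand : (a ⊕ y) ⊛ (a ⊕ y) ≈ y ⊛ y ⊕ a ⊛ ((y ⊕ y) ⊕ a)
      square-expand = solve 2 (λ a y →
        (a :+ y) :* (a :+ y) := y :* y :+ a :* ((y :+ y) :+ a)) refl a y
      a[y+y+a]≈b : a ⊛ ((y ⊕ y) ⊕ a) ≈ b
      a[y+y+a]≈b = begin
        a ⊛ ((y ⊕ y) ⊕ a)                       ≈⟨ *-congˡ (+-congʳ (distribʳ (u ⊛ b ⊕ - a) t t)) ⟨
        a ⊛ ((t ⊕ t) ⊛ (u ⊛ b ⊕ - a) ⊕ a)       ≈⟨ *-congˡ (+-congʳ (*-congʳ (half+half≈1 2t≈1))) ⟩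
        a ⊛ (1# ⊛ (u ⊛ b ⊕ - a) ⊕ a)            ≈⟨ *-congˡ (+-congʳ (*-identityˡ _)) ⟩
        a ⊛ ((u ⊛ b ⊕ - a) ⊕ a)                 ≈⟨ *-congˡ (//-rightDividesˡ a (u ⊛ b)) ⟩
        a ⊛ (u ⊛ b)                             ≈⟨ *-assoc a u b ⟨
        (a ⊛ u) ⊛ b                             ≈⟨ *-congʳ (trans (*-comm a u) ua≈1) ⟩
        1# ⊛ b                                  ≈⟨ *-identityˡ b ⟩
        b                                       ∎

  localSpec : ∀ {I} → IsLocalWith R I → SpecEnumeration R 1 (λ _ → I)
  localSpec (I-maximal , unique) = record
    { allMaximal = λ _ → I-maximal
    ; complete   = λ J J-maximal → Fin.zero , λ x → ⇔-sym (unique J J-maximal x)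
    ; distinct   = λ { Fin.zero Fin.zero _ → ≡.refl }
    }

module FiniteRing (R : CommutativeRing 0ℓ 0ℓ) {r : ℕ}
    (card : HasCardinality (CommutativeRing.Carrier R) (CommutativeRing._≈_ R) r) where
  open CommutativeRing R renaming (_+_ to _⊕_; _*_ to _⊛_)
  open HasCardinality card
  open import Algebra.Solver.Ring.NaturalCoefficients.Default commutativeSemiring
    using (solve; _:=_; _:+_; _:*_)

  index : Carrier → Fin r
  index x = proj₁ (surj x)

  enum-index : ∀ x → enum (index x) ≈ x
  enum-index x = proj₂ (surj x)

  _≟_ : Decidable _≈_
  x ≟ y = map′
    (λ i≡j → trans (sym (enum-index x)) (trans (reflexive (≡.cong enum i≡j)) (enum-index y)))
    (λ x≈y → inj _ _ (trans (enum-index x) (trans x≈y (sym (enum-index y)))))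
    (index x FinP.≟ index y)

  ∃? : {P : Carrier → Set} → (∀ {x y} → x ≈ y → P x → P y) → (∀ x → Dec (P x)) → Dec (∃ P)
  ∃? resp P? = map′ (λ (i , Pi) → enum i , Pi) (λ (x , Px) → index x , resp (sym (enum-index x)) Px)
                    (FinP.any? (P? ∘ enum))

  isUnit? : ∀ a → Dec (IsUnit R a)
  isUnit? a = ∃? (λ u≈v ua≈1 → trans (*-congʳ (sym u≈v)) ua≈1) (λ u → (u ⊛ a) ≟ 1#)

  _⊆ᴿ_ : (Carrier → Set) → (Carrier → Set) → Set
  _⊆ᴿ_ = _⊆_ R

  record DecIdeal : Set₁ where
    field
      P        : Carrier → Set
      P?       : ∀ x → Dec (P x)
      resp     : ∀ {x y} → x ≈ y → P x → P y
      zero∈    : P 0#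
      +-closed : ∀ {x y} → P x → P y → P (x ⊕ y)
      *-closed : ∀ s {x} → P x → P (s ⊛ x)

  open DecIdeal

  zeroIdeal : DecIdeal
  zeroIdeal = record
    { P        = _≈ 0#
    ; P?       = _≟ 0#
    ; resp     = λ x≈y x≈0 → trans (sym x≈y) x≈0
    ; zero∈    = refl
    ; +-closed = λ x≈0 y≈0 → trans (+-cong x≈0 y≈0) (+-identityˡ 0#)
    ; *-closed = λ s x≈0 → trans (*-congˡ x≈0) (zeroʳ s)
    }

  _+⟨_⟩ : DecIdeal → Carrier → DecIdeal
  J +⟨ y ⟩ = record
    { P        = J+Ry
    ; P?       = λ z → ∃? (λ w≈w′ (c , Jw , e) → c , resp J w≈w′ Jw , trans e (+-congʳ w≈w′))
                          (λ w → ∃? (λ c≈c′ (Jw , e) → Jw , trans e (+-congˡ (*-congʳ c≈c′)))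
                                    (λ c → P? J w ×-dec (z ≟ (w ⊕ c ⊛ y))))
    ; resp     = λ z≈z′ (w , c , Jw , e) → w , c , Jw , trans (sym z≈z′) e
    ; zero∈    = 0# , 0# , zero∈ J , sym (trans (+-congˡ (zeroˡ y)) (+-identityˡ 0#))
    ; +-closed = λ (w , c , Jw , e) (w′ , c′ , Jw′ , e′) →
        w ⊕ w′ , c ⊕ c′ , +-closed J Jw Jw′ , trans (+-cong e e′) (sum-of-combinations w c w′ c′)
    ; *-closed = λ s (w , c , Jw , e) →
        s ⊛ w , s ⊛ c , *-closed J s Jw , trans (*-congˡ e) (scaled-combination s w c)
    }
    where
      J+Ry : Carrier → Set
      J+Ry z = ∃[ w ] ∃[ c ] (P J w × z ≈ w ⊕ c ⊛ y)
      sum-of-combinations : ∀ w c w′ c′ → (w ⊕ c ⊛ y) ⊕ (w′ ⊕ c′ ⊛ y) ≈ (w ⊕ w′) ⊕ (c ⊕ c′) ⊛ y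
      sum-of-combinations w c w′ c′ = solve 5 (λ w c w′ c′ y →
        (w :+ c :* y) :+ (w′ :+ c′ :* y) := (w :+ w′) :+ (c :+ c′) :* y) refl w c w′ c′ y
      scaled-combination : ∀ s w c → s ⊛ (w ⊕ c ⊛ y) ≈ s ⊛ w ⊕ (s ⊛ c) ⊛ y
      scaled-combination s w c = solve 4 (λ s w c y →
        s :* (w :+ c :* y) := s :* w :+ (s :* c) :* y) refl s w c y

  +⟨⟩-∋ : ∀ J y → P (J +⟨ y ⟩) y
  +⟨⟩-∋ J y = 0# , 1# , zero∈ J , sym (trans (+-identityˡ _) (*-identityˡ y))

  +⟨⟩-⊇ : ∀ J y → P J ⊆ᴿ P (J +⟨ y ⟩)
  +⟨⟩-⊇ J y z Jz = z , 0# , Jz , sym (trans (+-congˡ (zeroˡ y)) (+-identityʳ z))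

  +⟨⟩-least : ∀ J y {Q} → IsIdeal R Q → P J ⊆ᴿ Q → Q y → P (J +⟨ y ⟩) ⊆ᴿ Q
  +⟨⟩-least J y Q-ideal J⊆Q Qy z (w , c , Jw , e) =
    Q.resp (sym e) (Q.+-closed (J⊆Q w Jw) (Q.*-closed c Qy))
    where module Q = IsIdeal Q-ideal

  ProperDecIdeal : Set₁
  ProperDecIdeal = Σ DecIdeal λ J → ¬ P J 1#

  ⟦_⟧ : ProperDecIdeal → Carrier → Set
  ⟦ J , _ ⟧ = P J

  isIdeal : (J : ProperDecIdeal) → IsIdeal R ⟦ J ⟧
  isIdeal (J , 1∉J) = record
    { resp = resp J ; zero∈ = zero∈ J ; +-closed = +-closed J ; *-closed = *-closed J ; proper = 1∉J }

  adjoinIfProper : (J : ProperDecIdeal) (y : Carrier) → Dec (P (proj₁ J +⟨ y ⟩) 1#) → ProperDecIdeal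
  adjoinIfProper J       y (yes _)      = J
  adjoinIfProper (J , _) y (no 1∉J+Ry) = J +⟨ y ⟩ , 1∉J+Ry

  adjoinIfProper-⊇ : ∀ J y d → ⟦ J ⟧ ⊆ᴿ ⟦ adjoinIfProper J y d ⟧
  adjoinIfProper-⊇ J       y (yes _) _ Jz = Jz
  adjoinIfProper-⊇ (J , _) y (no _)       = +⟨⟩-⊇ J y

  adjoinIfProper-∋ : ∀ J y d {Q} → IsIdeal R Q → ⟦ adjoinIfProper J y d ⟧ ⊆ᴿ Q → Q y →
                     ⟦ adjoinIfProper J y d ⟧ y
  adjoinIfProper-∋ (J , _) y (yes 1∈J+Ry) Q-ideal J⊆Q Qy =
    ⊥-elim (IsIdeal.proper Q-ideal (+⟨⟩-least J y Q-ideal J⊆Q Qy 1# 1∈J+Ry))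
  adjoinIfProper-∋ (J , _) y (no _) _ _ _ = +⟨⟩-∋ J y

  adjoin : ProperDecIdeal → Carrier → ProperDecIdeal
  adjoin J y = adjoinIfProper J y (P? (proj₁ J +⟨ y ⟩) 1#)

  adjoinAll : ProperDecIdeal → List Carrier → ProperDecIdeal
  adjoinAll = foldl adjoin

  adjoinAll-⊇ : ∀ J ys → ⟦ J ⟧ ⊆ᴿ ⟦ adjoinAll J ys ⟧
  adjoinAll-⊇ J []       _ Jz = Jz
  adjoinAll-⊇ J (y ∷ ys) z Jz =
    adjoinAll-⊇ (adjoin J y) ys z (adjoinIfProper-⊇ J y (P? (proj₁ J +⟨ y ⟩) 1#) z Jz)

  adjoinAll-∋ : ∀ J {ys y Q} → y ∈ ys → IsIdeal R Q → ⟦ adjoinAll J ys ⟧ ⊆ᴿ Q → Q y →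
                ⟦ adjoinAll J ys ⟧ y
  adjoinAll-∋ J {y ∷ ys} (here ≡.refl) Q-ideal M⊆Q Qy =
    adjoinAll-⊇ (adjoin J y) ys y
      (adjoinIfProper-∋ J y (P? (proj₁ J +⟨ y ⟩) 1#) Q-ideal
        (λ z → M⊆Q z ∘ adjoinAll-⊇ (adjoin J y) ys z) Qy)
  adjoinAll-∋ J {y′ ∷ ys} (there y∈ys) = adjoinAll-∋ (adjoin J y′) y∈ys

  -- Any element of a proper ideal above the result would have been adjoined at its turn.
  adjoinAll-maximal : ∀ J → IsMaximalIdeal R ⟦ adjoinAll J (tabulate enum) ⟧
  adjoinAll-maximal J = record
    { isIdeal = isIdeal (adjoinAll J (tabulate enum))
    ; maximal = λ Q Q-ideal M⊆Q z Qz →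
        resp (proj₁ (adjoinAll J (tabulate enum))) (enum-index z)
          (adjoinAll-∋ J (∈-tabulate⁺ (index z)) Q-ideal M⊆Q
            (IsIdeal.resp Q-ideal (sym (enum-index z)) Qz))
    }

  principalIdeal : ∀ a → ¬ IsUnit R a → ProperDecIdeal
  principalIdeal a a-nonunit = zeroIdeal +⟨ a ⟩ , λ (w , c , w≈0 , 1≈w+ca) →
    a-nonunit (c , sym (trans 1≈w+ca (trans (+-congʳ w≈0) (+-identityˡ _))))

  nonUnit⇒∈maximalIdeal : ∀ {a} → ¬ IsUnit R a → ∃[ M ] (IsMaximalIdeal R M × M a)
  nonUnit⇒∈maximalIdeal {a} a-nonunit =
    ⟦ adjoinAll (principalIdeal a a-nonunit) (tabulate enum) ⟧ ,
    adjoinAll-maximal (principalIdeal a a-nonunit) ,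
    adjoinAll-⊇ (principalIdeal a a-nonunit) (tabulate enum) a (+⟨⟩-∋ zeroIdeal a)

module _ (R : CommutativeRing 0ℓ 0ℓ) (G : Group 0ℓ 0ℓ) {r : ℕ}
    (card : HasCardinality (CommutativeRing.Carrier R) (CommutativeRing._≈_ R) r)
    (two : TwoInvertible R)
    (h : Group.Carrier G → Group.Carrier (R×R-group R)) (h-surj : IsSurjectiveHom G R h) where
  open CommutativeRing R using (Carrier; 0#; refl; *-cong) renaming (_+_ to _⊕_; _*_ to _⊛_)
  open HasCardinality card using (enum)
  open FiniteRing R card using (index; enum-index; isUnit?; nonUnit⇒∈maximalIdeal)
  open DifferenceSets G
  private
    module G = Group G
    module RR = Group (R×R-group R)
    module h = GroupMorphisms.IsGroupHomomorphism (proj₁ h-surj)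

  parabolaLift : Carrier → G.Carrier
  parabolaLift z = proj₁ (proj₂ h-surj (z , z ⊛ z))

  parabolaLifts : List G.Carrier
  parabolaLifts = map parabolaLift (tabulate enum)

  length-parabolaLifts : length parabolaLifts ≡ r
  length-parabolaLifts = ≡.trans (length-map parabolaLift (tabulate enum)) (length-tabulate enum)

  parabolaLifts-hit : ∀ z → ∃[ l ] (l ∈ parabolaLifts × h l RR.≈ (z , z ⊛ z))
  parabolaLifts-hit z =
    parabolaLift (enum (index z)) , ∈-map⁺ parabolaLift (∈-tabulate⁺ (index z)) ,
    RR.trans (proj₂ (proj₂ h-surj _)) (enum-index z , *-cong (enum-index z) (enum-index z))

  unit⇒isDifference : ∀ {BK} → IsDifferenceBasis G (Kernel G R h) BK →
    ∀ g → IsUnit R (proj₁ (h g)) → IsDifferenceOf (leftTranslates parabolaLifts BK) g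
  unit⇒isDifference BK-basis g a-unit
    with y , b+y²≈x² ← parabola-difference R two a-unit (proj₂ (h g))
    with lx , lx∈ , hlx≈ ← parabolaLifts-hit (proj₁ (h g) ⊕ y)
       | ly , ly∈ , hly≈ ← parabolaLifts-hit y =
    isDifferenceOf-unconjugate lx∈ ly∈ (BK-basis _ (homo-conjugate≈ε {G} {R×R-group R} (proj₁ h-surj)
      lx g ly (RR.trans (RR.∙-congˡ hly≈) (RR.trans (refl , b+y²≈x²) (RR.sym hlx≈)))))

  preimage-∋ε : ∀ {I} → IsMaximalIdeal R I → PreimageIdeal×R G R h I G.ε
  preimage-∋ε I-maximal = resp (CommutativeRing.sym R (proj₁ h.ε-homo)) zero∈
    where open IsIdeal (IsMaximalIdeal.isIdeal I-maximal)

  nonUnit⇒inSpec : ∀ {s M} → SpecEnumeration R s M →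
    ∀ g → ¬ IsUnit R (proj₁ (h g)) → ∃[ i ] PreimageIdeal×R G R h (M i) g
  nonUnit⇒inSpec spec g a-nonunit
    with J , J-maximal , Ja ← nonUnit⇒∈maximalIdeal a-nonunit
    with i , Mi≐J ← SpecEnumeration.complete spec J J-maximal =
    i , Equivalence.from (Mi≐J _) Ja

  isDifference-or-inSpec : ∀ {BK s M} → IsDifferenceBasis G (Kernel G R h) BK → SpecEnumeration R s M →
    ∀ g → IsDifferenceOf (leftTranslates parabolaLifts BK) g ⊎ ∃[ i ] PreimageIdeal×R G R h (M i) g
  isDifference-or-inSpec BK-basis spec g with isUnit? (proj₁ (h g))
  ... | yes a-unit   = inj₁ (unit⇒isDifference BK-basis g a-unit)
  ... | no a-nonunit = inj₂ (nonUnit⇒inSpec spec g a-nonunit)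

  differenceSize-bound : ∀ {dG dK} →
    DifferenceSize G (Whole G) dG → DifferenceSize G (Kernel G R h) dK →
    ∀ {s M d} → SpecEnumeration R s M → (∀ i → DifferenceSize G (PreimageIdeal×R G R h (M i)) (d i)) →
    dG + s ≤ dK * r + sum (tabulate d)
  differenceSize-bound {dG} {dK} (_ , minimal) ((BK , BK-basis , |BK|≡dK) , _) {s} {M} {d} spec Δ[Mᵢ]
    with k , _ , k∈BK , _ ← BK-basis G.ε h.ε-homo
       | l , l∈lifts , _ ← parabolaLifts-hit 0# =
    begin
      dG + s                                                ≤⟨ ℕ.+-monoˡ-≤ s (minimal L L-basis) ⟩
      length L + s                                          ≡⟨ length-anchoredUnion B₀ (l G.∙ k) c t ⟩
      length B₀ + sum (tabulate λ i → length (c i ∷ t i))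
        ≡⟨ ≡.cong₂ _+_ |B₀| (≡.cong sum (tabulate-cong |Bᵢ|)) ⟩
      dK * r + sum (tabulate d)                             ∎
    where
      open ℕ.≤-Reasoning
      B₀ : List G.Carrier
      B₀ = leftTranslates parabolaLifts BK
      |B₀| : length B₀ ≡ dK * r
      |B₀| = ≡.trans (length-leftTranslates parabolaLifts BK)
               (≡.trans (≡.cong₂ _*_ length-parabolaLifts |BK|≡dK) (ℕ.*-comm r dK))
      basisᵢ : ∀ i → ∃₂ λ c t →
               IsDifferenceBasis G (PreimageIdeal×R G R h (M i)) (c ∷ t) × length (c ∷ t) ≡ d i
      basisᵢ i = minimalBasis-∷ (preimage-∋ε (SpecEnumeration.allMaximal spec i)) (Δ[Mᵢ] i)
      c : Fin s → G.Carrier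
      c i = proj₁ (basisᵢ i)
      t : Fin s → List G.Carrier
      t i = proj₁ (proj₂ (basisᵢ i))
      |Bᵢ| : ∀ i → length (c i ∷ t i) ≡ d i
      |Bᵢ| i = proj₂ (proj₂ (proj₂ (basisᵢ i)))
      L : List G.Carrier
      L = anchoredUnion B₀ (l G.∙ k) c t
      L-basis : IsDifferenceBasis G (Whole G) L
      L-basis = anchoredUnion-basis (∈-leftTranslates l∈lifts k∈BK)
        (λ i → proj₁ (proj₂ (proj₂ (basisᵢ i)))) (λ g _ → isDifference-or-inSpec BK-basis spec g)

theorem5p2 : (R : CommutativeRing 0ℓ 0ℓ) (G : Group 0ℓ 0ℓ)
    (r : ℕ) → HasCardinality (CommutativeRing.Carrier R) (CommutativeRing._≈_ R) r
    → IsFinite (Group.Carrier G) (Group._≈_ G)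
    → TwoInvertible R
    → (h : Group.Carrier G → Group.Carrier (R×R-group R))
    → IsSurjectiveHom G R h
    → (dG dK : ℕ)
    → DifferenceSize G (Whole G) dG
    → DifferenceSize G (Kernel G R h) dK
    → ((s : ℕ) (M : Fin s → CommutativeRing.Carrier R → Set) → SpecEnumeration R s M
        → (d : Fin s → ℕ)
        → (∀ i → DifferenceSize G (PreimageIdeal×R G R h (M i)) (d i))
        → dG + s ≤ dK * r + sum (tabulate d))
      × ((Im : CommutativeRing.Carrier R → Set) → IsLocalWith R Im
        → (dI : ℕ) → DifferenceSize G (PreimageIdeal×R G R h Im) dI
        → dG + 1 ≤ dK * r + dI)
theorem5p2 R G r card _ two h h-surj dG dK Δ[G] Δ[K] =
  (λ s M spec d Δ[Mᵢ] → bound spec Δ[Mᵢ]) ,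
  (λ Im Im-local dI Δ[Im] → ≡.subst (λ n → dG + 1 ≤ dK * r + n) (ℕ.+-identityʳ dI)
     (bound {d = λ _ → dI} (localSpec R Im-local) (λ _ → Δ[Im])))
  where
    bound : ∀ {s M d} → SpecEnumeration R s M →
      (∀ i → DifferenceSize G (PreimageIdeal×R G R h (M i)) (d i)) → dG + s ≤ dK * r + sum (tabulate d)
    bound = differenceSize-bound R G card two h h-surj Δ[G] Δ[K]
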